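{- If $n$ is a positive integer and $k$ is a prime, then $(k-1)\, r_k(n) \le r_k(nk)$.
   Context: A $k$-term arithmetic progression ($k$-AP) is a sequence $a, a+d, \dots, a+(k-1)d$ of integers with common difference $d \ge 1$. For positive integers $k, n$, $r_k(n)$ denotes the maximum cardinality of a set $A \subseteq \{1,2,\dots,n\}$ that contains no $k$-AP. -}

module Defs where

open import Data.Nat using (ℕ; zero; suc; _+_; _*_; _∸_; _≤_; _<_)
open import Data.Product using (Σ; _×_; ∃-syntax)
open import Data.Fin.Subset using (Subset; _∈_; ∣_∣)
open import Data.Fin using (Fin; toℕ)
open import Relation.Nullary using (¬_)
open import Relation.Binary.PropositionalEquality using (_≡_)

-- Membership of a natural number x in a subset A of {1,…,n}.
-- A : Subset n represents a subset of {1,…,n}: index i : Fin n stands for i+1.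
_∈[_]_ : ℕ → (n : ℕ) → Subset n → Set
x ∈[ n ] A = Σ (Fin n) λ i → (suc (toℕ i) ≡ x) × (i ∈ A)

-- A contains a k-term arithmetic progression a, a+d, …, a+(k-1)d with d ≥ 1
-- (a ranges over integers; any such AP inside {1,…,n} has a ≥ 1, so a : ℕ suffices).
ContainsAP : (k n : ℕ) → Subset n → Set
ContainsAP k n A = ∃[ a ] ∃[ d ] (1 ≤ d) × (∀ j → j < k → (a + j * d) ∈[ n ] A)

APFree : (k n : ℕ) → Subset n → Set
APFree k n A = ¬ ContainsAP k n A

IsRk : (k n r : ℕ) → Set
IsRk k n r = (∃[ A ] (APFree k n A × ∣ A ∣ ≡ r))
           × (∀ (A : Subset n) → APFree k n A → ∣ A ∣ ≤ r)

-- Given a k-AP-free A ⊆ {1,…,n}, replace every element q+1 of A by the block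
-- {qk+1, …, qk+k-1} ⊆ {1,…,nk}. The resulting set B has (k-1)|A| elements and
-- contains no multiple of k. A k-AP x_j = a + jd in B is impossible: if k ∣ d,
-- the blocks ⌊x_j/k⌋ + 1 form a k-AP in A; if k ∤ d, then since k is prime the
-- x_j run through all residues mod k, so some x_j is a multiple of k.
module Submission where

open import Defs
open import Data.Nat
  using (ℕ; zero; suc; pred; _+_; _*_; _∸_; _≤_; _<_; z≤n; s≤s; s≤s⁻¹; NonZero; ≢-nonZero; >-nonZero)
open import Data.Nat.Properties
open import Data.Nat.DivMod
open import Data.Nat.Divisibility
open import Data.Nat.Primality using (Prime; euclidsLemma; ¬prime[0])
open import Data.Bool using (Bool; true; false)
open import Data.Vec using (Vec; []; _∷_; _++_; [_])
open import Data.Vec.Base using (here; there)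
open import Data.Fin as Fin using (Fin; toℕ; fromℕ<) renaming (zero to fzero; suc to fsuc)
open import Data.Fin.Properties using (pigeonhole; toℕ<n; fromℕ<-injective)
open import Data.Fin.Subset using (Subset; _∈_; ∣_∣)
open import Data.Product using (_×_; _,_; proj₁; proj₂; ∃-syntax)
open import Data.Sum using (_⊎_; inj₁; inj₂; [_,_]′)
open import Relation.Nullary using (¬_; yes; no; contradiction)
open import Relation.Binary.PropositionalEquality using (_≡_; _≢_; refl; sym; trans; cong; cong₂; subst; module ≡-Reasoning)

-- With k = suc k', block q of blowUp k' A covers {qk+1, …, qk+k}; its last entry,
-- the multiple qk+k, is always outside.
block : ∀ k' → Bool → Vec Bool (suc k')
block zero     b = [ false ]
block (suc k') b = b ∷ block k' b

blowUp : ∀ k' {n} → Subset n → Subset (n * suc k')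
blowUp k' []      = []
blowUp k' (b ∷ A) = block k' b ++ blowUp k' A

∣++∣ : ∀ {m n} (xs : Vec Bool m) (ys : Vec Bool n) → ∣ xs ++ ys ∣ ≡ ∣ xs ∣ + ∣ ys ∣
∣++∣ []           ys = refl
∣++∣ (true ∷ xs)  ys = cong suc (∣++∣ xs ys)
∣++∣ (false ∷ xs) ys = ∣++∣ xs ys

∣block∣ : ∀ k' b → ∣ block k' b ∣ ≡ k' * ∣ [ b ] ∣
∣block∣ zero     b = refl
∣block∣ (suc k') b = begin
  ∣ [ b ] ++ block k' b ∣         ≡⟨ ∣++∣ [ b ] (block k' b) ⟩
  ∣ [ b ] ∣ + ∣ block k' b ∣      ≡⟨ cong (∣ [ b ] ∣ +_) (∣block∣ k' b) ⟩
  ∣ [ b ] ∣ + k' * ∣ [ b ] ∣      ∎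
  where open ≡-Reasoning

∣blowUp∣ : ∀ k' {n} (A : Subset n) → ∣ blowUp k' A ∣ ≡ k' * ∣ A ∣
∣blowUp∣ k' []      = sym (*-zeroʳ k')
∣blowUp∣ k' (b ∷ A) = begin
  ∣ block k' b ++ blowUp k' A ∣          ≡⟨ ∣++∣ (block k' b) (blowUp k' A) ⟩
  ∣ block k' b ∣ + ∣ blowUp k' A ∣       ≡⟨ cong₂ _+_ (∣block∣ k' b) (∣blowUp∣ k' A) ⟩
  k' * ∣ [ b ] ∣ + k' * ∣ A ∣            ≡⟨ *-distribˡ-+ k' ∣ [ b ] ∣ ∣ A ∣ ⟨
  k' * (∣ [ b ] ∣ + ∣ A ∣)               ≡⟨ cong (k' *_) (∣++∣ [ b ] A) ⟨
  k' * ∣ b ∷ A ∣                         ∎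
  where open ≡-Reasoning

∈-++⁻ : ∀ {m n x} (xs : Vec Bool m) (ys : Vec Bool n) → x ∈[ m + n ] (xs ++ ys) →
        x ∈[ m ] xs ⊎ ∃[ y ] x ≡ m + y × y ∈[ n ] ys
∈-++⁻ []       ys x∈ = inj₂ (_ , refl , x∈)
∈-++⁻ (b ∷ xs) ys (fzero , refl , here) = inj₁ (fzero , refl , here)
∈-++⁻ (b ∷ xs) ys (fsuc i , refl , there i∈) with ∈-++⁻ xs ys (i , refl , i∈)
... | inj₁ (j , eq , j∈) = inj₁ (fsuc j , cong suc eq , there j∈)
... | inj₂ (y , eq , y∈) = inj₂ (y , cong suc eq , y∈)

∈-block⁻ : ∀ k' {b} {i : Fin (suc k')} → i ∈ block k' b → b ≡ true × toℕ i < k'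
∈-block⁻ zero     {i = fzero}  ()
∈-block⁻ (suc k') {i = fzero}  here       = refl , s≤s z≤n
∈-block⁻ (suc k') {i = fsuc i} (there i∈) with ∈-block⁻ k' i∈
... | b≡true , i<k' = b≡true , s≤s i<k'

∈-blowUp-position : ∀ k' {n} (A : Subset n) {x} → x ∈[ n * suc k' ] blowUp k' A →
            ∃[ q ] ∃[ s ] s < k' × x ≡ q * suc k' + suc s × suc q ∈[ n ] A
∈-blowUp-position k' (b ∷ A) x∈ with ∈-++⁻ (block k' b) (blowUp k' A) x∈
... | inj₁ (i , refl , i∈) with ∈-block⁻ k' i∈
...   | refl , i<k' = 0 , toℕ i , i<k' , refl , fzero , refl , here
∈-blowUp-position k' (b ∷ A) x∈ | inj₂ (y , refl , y∈) with ∈-blowUp-position k' A y∈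
... | q , s , s<k' , refl , (i , eq , i∈) =
  suc q , s , s<k' , sym (+-assoc (suc k') (q * suc k') (suc s)) , fsuc i , cong suc eq , there i∈

∈-blowUp⁻ : ∀ k' {n} (A : Subset n) {x} → x ∈[ n * suc k' ] blowUp k' A →
            ¬ suc k' ∣ x × suc (x / suc k') ∈[ n ] A
∈-blowUp⁻ k' A x∈ with ∈-blowUp-position k' A x∈
... | q , s , s<k' , refl , q+1∈A = k∤x , subst (λ y → suc y ∈[ _ ] A) (sym x/k≡q) q+1∈A
  where
  k = suc k'
  k∤x : ¬ k ∣ q * k + suc s
  k∤x k∣x = <⇒≱ (s≤s s<k') (∣⇒≤ (∣m+n∣m⇒∣n k∣x (n∣m*n q)))
  x/k≡q : (q * k + suc s) / k ≡ q
  x/k≡q = begin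
    (q * k + suc s) / k     ≡⟨ +-distrib-/-∣ˡ (suc s) (n∣m*n q) ⟩
    q * k / k + suc s / k   ≡⟨ cong₂ _+_ (m*n/n≡m q k) (m<n⇒m/n≡0 (s≤s s<k')) ⟩
    q + 0                   ≡⟨ +-identityʳ q ⟩
    q                       ∎
    where open ≡-Reasoning

%≡%⇒∣∸ : ∀ x y p .{{_ : NonZero p}} → x % p ≡ y % p → p ∣ y ∸ x
%≡%⇒∣∸ x y p x%p≡y%p = divides (y / p ∸ x / p) (begin
  y ∸ x                                      ≡⟨ cong₂ _∸_ (m≡m%n+[m/n]*n y p) (m≡m%n+[m/n]*n x p) ⟩
  (y % p + y / p * p) ∸ (x % p + x / p * p)  ≡⟨ cong (λ r → (y % p + y / p * p) ∸ (r + x / p * p)) x%p≡y%p ⟩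
  (y % p + y / p * p) ∸ (y % p + x / p * p)  ≡⟨ [m+n]∸[m+o]≡n∸o (y % p) (y / p * p) (x / p * p) ⟩
  y / p * p ∸ x / p * p                      ≡⟨ *-distribʳ-∸ p (y / p) (x / p) ⟨
  (y / p ∸ x / p) * p                        ∎)
  where open ≡-Reasoning

ap-terms-incongruent : ∀ {p d} a {i j} → Prime p → ¬ p ∣ d → i < j → j < p →
                       ¬ p ∣ (a + j * d) ∸ (a + i * d)
ap-terms-incongruent {p} {d} a {i} {j} p-prime p∤d i<j j<p p∣xⱼ∸xᵢ =
  [ p∤j∸i , p∤d ]′ (euclidsLemma (j ∸ i) d p-prime (subst (p ∣_) xⱼ∸xᵢ≡[j∸i]d p∣xⱼ∸xᵢ))
  where
  xⱼ∸xᵢ≡[j∸i]d : (a + j * d) ∸ (a + i * d) ≡ (j ∸ i) * d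
  xⱼ∸xᵢ≡[j∸i]d = trans ([m+n]∸[m+o]≡n∸o a (j * d) (i * d)) (sym (*-distribʳ-∸ d j i))
  p∤j∸i : ¬ p ∣ j ∸ i
  p∤j∸i p∣j∸i = <⇒≱ (≤-<-trans (m∸n≤m j i) j<p) (∣⇒≤ {{>-nonZero (m<n⇒0<n∸m i<j)}} p∣j∸i)

residues-of-nonmultiples-collide : ∀ {p'} (x : Fin (suc p') → ℕ) → (∀ j → ¬ suc p' ∣ x j) →
                                   ∃[ i ] ∃[ j ] i Fin.< j × x i % suc p' ≡ x j % suc p'
residues-of-nonmultiples-collide {p'} x p∤x =
  let i , j , i<j , same = pigeonhole (n<1+n p') nonzero-residue
  in  i , j , i<j , nonzero-residue-injective i j same
  where
  p = suc p'
  residue≢0 : ∀ j → x j % p ≢ 0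
  residue≢0 j r≡0 = p∤x j (m%n≡0⇒n∣m (x j) p r≡0)
  pred-residue<p' : ∀ j → pred (x j % p) < p'
  pred-residue<p' j = subst (_≤ p') (sym (suc-pred _ {{≢-nonZero (residue≢0 j)}})) (s≤s⁻¹ (m%n<n (x j) p))
  nonzero-residue : Fin p → Fin p'
  nonzero-residue j = fromℕ< (pred-residue<p' j)
  nonzero-residue-injective : ∀ i j → nonzero-residue i ≡ nonzero-residue j → x i % p ≡ x j % p
  nonzero-residue-injective i j same = begin
    x i % p               ≡⟨ suc-pred _ {{≢-nonZero (residue≢0 i)}} ⟨
    suc (pred (x i % p))  ≡⟨ cong suc (fromℕ<-injective _ _ (pred-residue<p' i) (pred-residue<p' j) same) ⟩
    suc (pred (x j % p))  ≡⟨ suc-pred _ {{≢-nonZero (residue≢0 j)}} ⟩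
    x j % p               ∎
    where open ≡-Reasoning

ap-hits-multiple : ∀ {p d} a → Prime p → ¬ p ∣ d → ¬ (∀ j → j < p → ¬ p ∣ a + j * d)
ap-hits-multiple {suc p'} {d} a p-prime p∤d avoids =
  let i , j , i<j , same = residues-of-nonmultiples-collide term (λ j → avoids (toℕ j) (toℕ<n j))
  in  ap-terms-incongruent a p-prime p∤d i<j (toℕ<n j) (%≡%⇒∣∸ (term i) (term j) (suc p') same)
  where
  term : Fin (suc p') → ℕ
  term j = a + toℕ j * d

[a+jd]/k≡a/k+j[d/k] : ∀ a j {d k} .{{_ : NonZero k}} → k ∣ d → (a + j * d) / k ≡ a / k + j * (d / k)
[a+jd]/k≡a/k+j[d/k] a j k∣d = trans (+-distrib-/-∣ʳ a (∣n⇒∣m*n j k∣d)) (cong (a / _ +_) (*-/-assoc j k∣d))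

blowUp-apFree : ∀ k' {n} (A : Subset n) → Prime (suc k') →
                APFree (suc k') n A → APFree (suc k') (n * suc k') (blowUp k' A)
blowUp-apFree k' {n} A k-prime A-free (a , d , 1≤d , ap) with suc k' ∣? d
... | no  k∤d = ap-hits-multiple a k-prime k∤d (λ j j<k → proj₁ (∈-blowUp⁻ k' A (ap j j<k)))
... | yes k∣d = A-free (suc (a / suc k') , d / suc k' , m≥n⇒m/n>0 (∣⇒≤ {{>-nonZero 1≤d}} k∣d) ,
  λ j j<k → subst (λ y → suc y ∈[ n ] A) ([a+jd]/k≡a/k+j[d/k] a j k∣d) (proj₂ (∈-blowUp⁻ k' A (ap j j<k))))

corollary1 : (n k : ℕ) → 0 < n → Prime k → (r₁ r₂ : ℕ) → IsRk k n r₁ → IsRk k (n * k) r₂ → (k ∸ 1) * r₁ ≤ r₂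
corollary1 n zero     _ zero-prime = contradiction zero-prime ¬prime[0]
corollary1 n (suc k') _ k-prime r₁ r₂ ((A , A-free , ∣A∣≡r₁) , _) (_ , r₂-max) = begin
  k' * r₁              ≡⟨ cong (k' *_) ∣A∣≡r₁ ⟨
  k' * ∣ A ∣           ≡⟨ ∣blowUp∣ k' A ⟨
  ∣ blowUp k' A ∣      ≤⟨ r₂-max (blowUp k' A) (blowUp-apFree k' A k-prime A-free) ⟩
  r₂                   ∎
  where open ≤-Reasoning
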